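{- Let $G_0,G_1\in\mathbb{Z}$, let $(G_n)_{n\ge0}$ satisfy $G_n=G_{n-1}+G_{n-2}$ for $n\ge2$, and let $D_{G_0,G_1}=G_1^2-G_0G_1-G_0^2$. For all integers $m>2$, $$(-1)^{\pi_{G_0,G_1}(m)}\cdot D_{G_0,G_1}\equiv D_{G_0,G_1}\pmod m.$$
   Context: For $m\ge2$, $\pi_{G_0,G_1}(m)$ is the smallest positive integer $r$ with $G_r\equiv G_0\pmod m$ and $G_{r+1}\equiv G_1\pmod m$. -}

module Defs where

open import Data.Nat using (ℕ; zero; suc; _<_; _≤_)
open import Data.Integer using (ℤ; _+_; _-_; _*_; -_; +_; ∣_∣)
open import Data.Integer.Divisibility using (_∣_)
open import Data.Product using (_×_)

G : ℤ → ℤ → ℕ → ℤ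
G G0 G1 zero = G0
G G0 G1 (suc zero) = G1
G G0 G1 (suc (suc n)) = G G0 G1 (suc n) + G G0 G1 n

_≡_[mod_] : ℤ → ℤ → ℕ → Set
a ≡ b [mod m ] = (+ m) ∣ (a - b)

D : ℤ → ℤ → ℤ
D G0 G1 = G1 * G1 - G0 * G1 - G0 * G0

negOnePow : ℕ → ℤ
negOnePow zero = + 1
negOnePow (suc n) = - negOnePow n

Returns : ℤ → ℤ → ℕ → ℕ → Set
Returns G0 G1 m r =
  (G G0 G1 r ≡ G0 [mod m ]) × (G G0 G1 (suc r) ≡ G1 [mod m ])

IsPisanoPeriod : ℤ → ℤ → ℕ → ℕ → Set
IsPisanoPeriod G0 G1 m r =
  (0 < r) × Returns G0 G1 m r × (∀ s → 0 < s → Returns G0 G1 m s → r ≤ s)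

{-# OPTIONS --safe #-}
-- D is the value of the quadratic form y² − xy − x² at (G₀, G₁). One step (x, y) ↦ (y, y + x)
-- of the recurrence negates this form, so D(G_n, G_{n+1}) = (−1)ⁿ D. At a return time r the
-- pair (G_r, G_{r+1}) is congruent to (G₀, G₁) modulo m, and the form respects congruences,
-- hence (−1)ʳ D ≡ D (mod m).
module Submission where

open import Defs
open import Data.Nat using (ℕ; _<_; zero; suc)
open import Data.Integer using (ℤ; _*_; _+_; _-_; -_; +_)
open import Data.Integer.Properties using (*-identityˡ; neg-distribˡ-*)
open import Data.Integer.Divisibility.Signed as Signed
  using (∣ᵤ⇒∣; ∣⇒∣ᵤ; ∣m∣n⇒∣m+n; ∣m∣n⇒∣m-n; ∣m⇒∣m*n; ∣n⇒∣m*n)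
open import Data.Integer.Tactic.RingSolver using (solve-∀)
open import Data.Product using (_,_)
open import Relation.Binary.PropositionalEquality using (_≡_; cong; sym; subst; module ≡-Reasoning)

D-step : ∀ x y → D y (y + x) ≡ - D x y
D-step = unfolded
  where
  -- the ring solver does not unfold D, so the identities are stated for its body
  unfolded : ∀ x y → (y + x) * (y + x) - y * (y + x) - y * y ≡ - (y * y - x * y - x * x)
  unfolded = solve-∀

D-consecutive : ∀ G0 G1 n → D (G G0 G1 n) (G G0 G1 (suc n)) ≡ negOnePow n * D G0 G1
D-consecutive G0 G1 zero = sym (*-identityˡ (D G0 G1))
D-consecutive G0 G1 (suc n) = begin
  D (G G0 G1 (suc n)) (G G0 G1 (suc n) + G G0 G1 n) ≡⟨ D-step (G G0 G1 n) (G G0 G1 (suc n)) ⟩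
  - D (G G0 G1 n) (G G0 G1 (suc n))                 ≡⟨ cong -_ (D-consecutive G0 G1 n) ⟩
  - (negOnePow n * D G0 G1)                          ≡⟨ neg-distribˡ-* (negOnePow n) (D G0 G1) ⟩
  negOnePow (suc n) * D G0 G1                        ∎
  where open ≡-Reasoning

D-difference : ∀ x y x′ y′ →
  D x y - D x′ y′ ≡ (y - y′) * (y + y′) - ((x - x′) * y + x′ * (y - y′)) - (x - x′) * (x + x′)
D-difference = unfolded
  where
  unfolded : ∀ x y x′ y′ → (y * y - x * y - x * x) - (y′ * y′ - x′ * y′ - x′ * x′) ≡
    (y - y′) * (y + y′) - ((x - x′) * y + x′ * (y - y′)) - (x - x′) * (x + x′)
  unfolded = solve-∀

D-cong : ∀ m x y x′ y′ → x ≡ x′ [mod m ] → y ≡ y′ [mod m ] → D x y ≡ D x′ y′ [mod m ]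
D-cong m x y x′ y′ x≡x′ y≡y′ =
  ∣⇒∣ᵤ (subst (+ m Signed.∣_) (sym (D-difference x y x′ y′))
    (∣m∣n⇒∣m-n (∣m∣n⇒∣m-n (∣m⇒∣m*n (y + y′) m∣Δy)
                           (∣m∣n⇒∣m+n (∣m⇒∣m*n y m∣Δx) (∣n⇒∣m*n x′ m∣Δy)))
               (∣m⇒∣m*n (x + x′) m∣Δx)))
  where
  m∣Δx : + m Signed.∣ (x - x′)
  m∣Δx = ∣ᵤ⇒∣ x≡x′
  m∣Δy : + m Signed.∣ (y - y′)
  m∣Δy = ∣ᵤ⇒∣ y≡y′

negOnePow-D-at-return : ∀ G0 G1 m r → Returns G0 G1 m r →
  (negOnePow r * D G0 G1) ≡ D G0 G1 [mod m ]
negOnePow-D-at-return G0 G1 m r (Gr≡G0 , Gr+1≡G1) =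
  subst (_≡ D G0 G1 [mod m ]) (D-consecutive G0 G1 r)
    (D-cong m (G G0 G1 r) (G G0 G1 (suc r)) G0 G1 Gr≡G0 Gr+1≡G1)

lemma5p2 : (G0 G1 : ℤ) (m r : ℕ) → 2 < m → IsPisanoPeriod G0 G1 m r →
    (negOnePow r * D G0 G1) ≡ D G0 G1 [mod m ]
lemma5p2 G0 G1 m r _ (_ , returns , _) = negOnePow-D-at-return G0 G1 m r returns
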